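{- Let $\mathcal{P}=(P,\leq^\mathcal{P})$ be a finite colored poset with a fixed chain partition. For every $p,p'\in P$ and $s\ge0$, if $\tau_s(p)\ne\tau_s(p')$ then $\tau_{s+1}(p)\neq\tau_{s+1}(p')$.
   Context: $\mathcal{P}$ is colored by $\lambda:P\to\Lambda$ ($\Lambda$ finite) and has a chain partition $(C_1,\dots,C_w)$; $C(p)=C_j$ for $p\in C_j$. Digraphs may have labeled vertices and arcs and parallel arcs; $R^D_r(v_1,\dots,v_k)$ is the set of vertices reachable in $D$ from some $v_i$ by a directed path of length at most $r$. Put $r_s=3\cdot4^s-1$. Let $\tau_0(p)=\langle\lambda(p),j\rangle$ where $C(p)=C_j$. Given $\tau_s$, $D_s$ is the digraph on $P$ with vertex labels $\tau_s$ and arcs: for every $p\in P$ and $j\in\{1,\dots,w\}$, an arc labeled 'max' from $p$ to the topmost element of $C_j$, an arc labeled 'min' from $p$ to the bottommost element of $C_j$, and for every value $t\in\{\tau_s(q):q\in C_j\}$ an arc labeled 'up' from $p$ to the bottommost $p'\in C_j$ with $p'\ne p$, $\tau_s(p')=t$, $p\leq^\mathcal{P}p'$ (if it exists) and an arc labeled 'down' from $p$ to the topmost $p'\in C_j$ with $p'\ne p$, $\tau_s(p')=t$, $p'\leq^\mathcal{P}p$ (if it exists). Let $P_s(p)=R^{D_s}_{r_s}(p)$ and $\mathcal{A}_s(p)$ the structure formed by the vertex- and arc-labeled induced subdigraph $D_s[P_s(p)]$ rooted at $p$ with $\leq^\mathcal{P}$ restricted to $P_s(p)$; $\tau_{s+1}(p)$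 is the isomorphism type of $\mathcal{A}_s(p)$ (isomorphisms preserve vertex labels, arc labels, root and order). -}

module Defs where

open import Data.Nat using (ℕ; zero; suc; _*_; _∸_; _^_)
open import Data.Fin using (Fin)
open import Data.Product using (_×_; ∃)
open import Data.Sum using (_⊎_)
open import Relation.Binary.PropositionalEquality using (_≡_; _≢_)
open import Relation.Binary.Structures using (IsPartialOrder)
open import Function.Bundles using (_⇔_)

-- A finite colored poset P = Fin n, colors Λ = Fin m, with a chain partition
-- (C_1,…,C_w) given by chain : Fin n → Fin w (p ∈ C_(chain p)).
record ColoredChainPoset (n m w : ℕ) : Set₁ where
  field
    _≤P_           : Fin n → Fin n → Set
    isPartialOrder : IsPartialOrder _≡_ _≤P_
    color          : Fin n → Fin m
    chain          : Fin n → Fin w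
    chain-isChain  : ∀ p q → chain p ≡ chain q → (p ≤P q) ⊎ (q ≤P p)
    chain-nonempty : ∀ j → ∃ λ p → chain p ≡ j

data ArcLabel : Set where
  max min up down : ArcLabel

radius : ℕ → ℕ
radius s = 3 * 4 ^ s ∸ 1

module _ {n m w : ℕ} (𝒫 : ColoredChainPoset n m w) where
  open ColoredChainPoset 𝒫

  IsTop : Fin n → Set
  IsTop q = ∀ x → chain x ≡ chain q → x ≤P q

  IsBot : Fin n → Set
  IsBot q = ∀ x → chain x ≡ chain q → q ≤P x

  -- Arcs of D_s, where E is the relation "τ_s x = τ_s y".
  -- Arc E l p q : there is an arc labelled l from p to q.
  Arc : (Fin n → Fin n → Set) → ArcLabel → Fin n → Fin n → Set
  Arc E max  p q = IsTop q
  Arc E min  p q = IsBot q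
  Arc E up   p q = (q ≢ p) × (p ≤P q) ×
    (∀ x → chain x ≡ chain q → x ≢ p → E x q → p ≤P x → q ≤P x)
  Arc E down p q = (q ≢ p) × (q ≤P p) ×
    (∀ x → chain x ≡ chain q → x ≢ p → E x q → x ≤P p → x ≤P q)

  data Reach (E : Fin n → Fin n → Set) : ℕ → Fin n → Fin n → Set where
    here : ∀ {r p} → Reach E r p p
    step : ∀ {r p y x} (l : ArcLabel) → Reach E r p y → Arc E l y x → Reach E (suc r) p x

  -- Isomorphism of the rooted structures A(p) and A(q): induced labelled subdigraph
  -- of D on R_r(p) resp. R_r(q), with vertex labels (via E), arc labels, root, order.
  record RootedIso (E : Fin n → Fin n → Set) (r : ℕ) (p q : Fin n) : Set where
    field
      f g      : Fin n → Fin n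
      f-into   : ∀ x → Reach E r p x → Reach E r q (f x)
      g-into   : ∀ y → Reach E r q y → Reach E r p (g y)
      gf       : ∀ x → Reach E r p x → g (f x) ≡ x
      fg       : ∀ y → Reach E r q y → f (g y) ≡ y
      root     : f p ≡ q
      vlabel   : ∀ x → Reach E r p x → E x (f x)
      arcs     : ∀ l x y → Reach E r p x → Reach E r p y → Arc E l x y ⇔ Arc E l (f x) (f y)
      order    : ∀ x y → Reach E r p x → Reach E r p y → (x ≤P y) ⇔ (f x ≤P f y)

  -- SameType s p q  ⇔  τ_s(p) = τ_s(q)
  SameType : ℕ → Fin n → Fin n → Set
  SameType zero    p q = (color p ≡ color q) × (chain p ≡ chain q)
  SameType (suc s) p q = RootedIso (SameType s) (radius s) p q

module Submission where

-- Proof idea.  τ_{s+1}(p) is the isomorphism type of the rooted structure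
-- 𝒜_s(p), whose vertices carry the labels τ_s.  An isomorphism of rooted
-- structures sends the root p to the root p′ and preserves vertex labels, so
-- τ_{s+1}(p) = τ_{s+1}(p′) forces τ_s(p) = τ_s(p′).  The theorem is the
-- contrapositive of this observation.

open import Defs
open import Data.Nat using (ℕ; suc)
open import Data.Fin using (Fin)
open import Relation.Nullary using (¬_)
open import Relation.Binary.PropositionalEquality using (subst)

rootedIso-rootLabel : ∀ {n m w : ℕ} (𝒫 : ColoredChainPoset n m w)
  (E : Fin n → Fin n → Set) (r : ℕ) {p q : Fin n} →
  RootedIso 𝒫 E r p q → E p q
rootedIso-rootLabel 𝒫 E r {p} iso =
  subst (E p) root (vlabel p (here {𝒫 = 𝒫}))
  where open RootedIso iso

lemma3p2 : ∀ {n m w : ℕ} (𝒫 : ColoredChainPoset n m w) (s : ℕ) (p p′ : Fin n) →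
    ¬ SameType 𝒫 s p p′ → ¬ SameType 𝒫 (suc s) p p′
lemma3p2 𝒫 s p p′ differentType sameNextType =
  differentType (rootedIso-rootLabel 𝒫 (SameType 𝒫 s) (radius s) sameNextType)
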